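{- Let $A$ be a finite alphabet with $|A| = a \ge 3$, let $n$ be a positive integer, and let $w$ be a universal partial word for $A^n$. Then the first $n-1$ characters of $w$ are equal (as a string over $A\cup\{\diamond\}$) to the last $n-1$ characters of $w$; in other words, $w$, viewed as a word over $A\cup\{\diamond\}$, has a border of length $n-1$.
   Context: A partial word over $A$ is a finite sequence of characters from $A \cup \{\diamond\}$, where $\diamond \notin A$ is a wild-card symbol; a word over $A$ contains no $\diamond$. $A^n$ denotes the set of words of length $n$ over $A$. For $x = x_1\cdots x_n \in A^n$ and a partial word $w = w_1\cdots w_N$, the position $i$ ($0 \le i \le N-n$) covers $x$ if $x_j = w_{i+j}$ for every $1\le j\le n$ with $w_{i+j}\in A$. A universal partial word for $A^n$ is a partial word $w$ such that every word in $A^n$ is covered by exactly one position of $w$. -}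

module Defs where

open import Data.Nat using (ℕ; _+_; _∸_; _≤_; _<_)
open import Data.Fin using (Fin)
open import Data.Maybe using (Maybe; just; nothing)
open import Data.List using (List; length; take; drop)
open import Data.Vec.Functional using (Vector)
open import Data.Product using (Σ; _×_; ∃)
open import Data.Sum using (_⊎_)
open import Relation.Binary.PropositionalEquality using (_≡_)

-- A partial word over the alphabet A = Fin a: a list over A ∪ {◇},
-- where `nothing` is the wild-card symbol ◇ and `just c` is the letter c.
PartialWord : ℕ → Set
PartialWord a = List (Maybe (Fin a))

at : ∀ {a} → PartialWord a → ℕ → Maybe (Maybe (Fin a))
at List.[] _ = nothing
at (c List.∷ w) ℕ.zero = just c
at (c List.∷ w) (ℕ.suc k) = at w k

-- A word of length n over Fin a: x_1 ⋯ x_n, represented 0-based as Fin n → Fin a.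
-- Position i (0 ≤ i ≤ N − n) covers x when, for every j < n, the character
-- w_{i+j} (0-based) is ◇ or equals x_j.
Covers : ∀ {a n} → PartialWord a → ℕ → Vector (Fin a) n → Set
Covers {a} {n} w i x =
  (i + n ≤ length w) ×
  ((j : Fin n) → (at w (i + Data.Fin.toℕ j) ≡ just nothing)
                 ⊎ (at w (i + Data.Fin.toℕ j) ≡ just (just (x j))))

IsUniversal : (a n : ℕ) → PartialWord a → Set
IsUniversal a n w =
  (x : Vector (Fin a) n) →
    Σ ℕ (λ i → Covers w i x × ((i′ : ℕ) → Covers w i′ x → i′ ≡ i))

HasBorder : ∀ {a} → ℕ → PartialWord a → Set
HasBorder k w = take k w ≡ drop (length w ∸ k) w

-- Fix u ∈ Aᵏ, where k = n − 1, and let G i ∈ {0, 1} record whether position i covers u.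
-- Position i covers u c iff it covers u and w_{i+k} admits c, and it covers c u iff i + 1
-- covers u and w_i admits c; a wild card admits all a letters, a letter only itself. Each
-- such word is covered exactly once, so with d = a − 1 ≥ 2 and L = |w| − k,
-- ∑_{i<L} G i ≡ a ≡ ∑_{i<L} G (i + 1) (mod d). Comparing both sums with ∑_{i≤L} G i
-- yields G 0 ≡ G L (mod d), hence G 0 = G L: positions 0 and L cover the same words of
-- length k. As a ≥ 2, the set of words a position covers determines the characters it reads,
-- so the first k characters of w equal the last k.

module Submission where

open import Defs
open import Data.Nat using (ℕ; zero; suc; _+_; _*_; _∸_; _≤_; _<_; s≤s; z≤n; _≤?_; _<?_)
open import Data.Nat.Properties
open import Data.Nat.DivMod using (_%_; [m+kn]%n≡m%n; m<n⇒m%n≡m)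
open import Data.Nat.Tactic.RingSolver using (solve-∀)
open import Data.Fin using (Fin; zero; suc; toℕ; fromℕ; fromℕ<; inject₁; punchIn)
open import Data.Fin.Properties using (toℕ-injective; toℕ-fromℕ<; toℕ-inject₁; toℕ-fromℕ; toℕ<n; punchInᵢ≢i; all?)
  renaming (_≟_ to _≟ᶠ_)
open import Data.Maybe using (Maybe; just; nothing)
import Data.Maybe.Properties as Maybe
open import Data.List using ([]; _∷_; length; take; drop)
open import Data.Vec.Functional using (Vector; head; tail; updateAt; removeAt) renaming (_∷_ to _∷ᵥ_)
open import Data.Vec.Functional.Properties using (updateAt-updates; updateAt-minimal)
open import Data.Product using (Σ; _×_; _,_; proj₁; proj₂)
open import Data.Sum using (_⊎_; inj₁; inj₂)
open import Function using (id; _∘_; const; case_of_; _⇔_; mk⇔; Equivalence)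
open import Relation.Nullary using (¬_; Dec; yes; no; contradiction)
open import Relation.Nullary.Decidable using (_×-dec_; _⊎-dec_)
open import Relation.Binary.Definitions using (DecidableEquality)
open import Relation.Binary.PropositionalEquality
open import Algebra.Properties.Semiring.Sum +-*-semiring
  using (sum; sum-syntax; sum-cong-≗; sum-remove; sum-replicate-zero; sum-init-last; ∑-distrib-+; ∑-comm; *-distribˡ-sum)

open Equivalence using (to; from)

private
  variable
    a d k n : ℕ
    P Q : Set

indicator : Dec P → ℕ
indicator (yes _) = 1
indicator (no _)  = 0

indicator-yes : (p : Dec P) → P → indicator p ≡ 1
indicator-yes (yes _) _ = refl
indicator-yes (no ¬p) p = contradiction p ¬p

indicator-no : (p : Dec P) → ¬ P → indicator p ≡ 0
indicator-no (yes p) ¬p = contradiction p ¬p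
indicator-no (no _)  _  = refl

indicator<2 : (p : Dec P) → indicator p < 2
indicator<2 (yes _) = s≤s (s≤s z≤n)
indicator<2 (no _)  = s≤s z≤n

indicator-× : (p : Dec P) (q : Dec Q) → indicator (p ×-dec q) ≡ indicator p * indicator q
indicator-× (yes p) (yes q) = indicator-yes (yes p ×-dec yes q) (p , q)
indicator-× (yes p) (no ¬q) = indicator-no (yes p ×-dec no ¬q) (¬q ∘ proj₂)
indicator-× (no ¬p) q       = indicator-no (no ¬p ×-dec q) (¬p ∘ proj₁)

indicator-cong : (p : Dec P) (q : Dec Q) → P ⇔ Q → indicator p ≡ indicator q
indicator-cong (yes p) q P⇔Q = sym (indicator-yes q (to P⇔Q p))
indicator-cong (no ¬p) q P⇔Q = sym (indicator-no q (¬p ∘ from P⇔Q))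

indicator-injective : (p : Dec P) (q : Dec Q) → indicator p ≡ indicator q → P ⇔ Q
indicator-injective (yes p) (yes q) _ = mk⇔ (const q) (const p)
indicator-injective (no ¬p) (no ¬q) _ = mk⇔ (λ p → contradiction p ¬p) (λ q → contradiction q ¬q)

∑-ones : (f : Fin n → ℕ) → (∀ i → f i ≡ 1) → ∑[ i < n ] f i ≡ n
∑-ones {zero}  f ones = refl
∑-ones {suc n} f ones = cong₂ _+_ (ones zero) (∑-ones (f ∘ suc) (ones ∘ suc))

∑-delta : (f : Fin n → ℕ) (i : Fin n) → f i ≡ 1 → (∀ j → j ≢ i → f j ≡ 0) → ∑[ j < n ] f j ≡ 1
∑-delta {suc n} f i fi≡1 others≡0 = begin
  sum f                       ≡⟨ sum-remove {i = i} f ⟩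
  f i + sum (removeAt f i)    ≡⟨ cong₂ _+_ fi≡1 (sum-cong-≗ (λ j → others≡0 (punchIn i j) (punchInᵢ≢i i j))) ⟩
  1 + ∑[ j < n ] 0            ≡⟨ cong suc (sum-replicate-zero n) ⟩
  1                           ∎
  where open ≡-Reasoning

double-count : ∀ d {m} (f : Fin m → Fin n → ℕ) (g h : Fin m → ℕ) →
               (∀ c → ∑[ i < m ] f i c ≡ 1) → (∀ i → ∑[ c < n ] f i c ≡ g i + d * h i) →
               sum g + d * sum h ≡ n
double-count {n} d {m} f g h columns rows = begin
  sum g + d * sum h                  ≡⟨ cong (sum g +_) (*-distribˡ-sum d h) ⟩
  sum g + ∑[ i < m ] (d * h i)       ≡⟨ ∑-distrib-+ g (λ i → d * h i) ⟨
  ∑[ i < m ] (g i + d * h i)         ≡⟨ sum-cong-≗ rows ⟨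
  ∑[ i < m ] ∑[ c < n ] f i c        ≡⟨ ∑-comm f ⟩
  ∑[ c < n ] ∑[ i < m ] f i c        ≡⟨ ∑-ones _ columns ⟩
  n                                  ∎
  where open ≡-Reasoning

-- A character is a value of `at`, with `nothing` off the end of the word;
-- `Covers w i x` unfolds to (i + n ≤ length w) × (∀ j → Matches (at w (i + toℕ j)) (x j)).
Matches : Maybe (Maybe (Fin a)) → Fin a → Set
Matches ch c = ch ≡ just nothing ⊎ ch ≡ just (just c)

matches? : (ch : Maybe (Maybe (Fin a))) (c : Fin a) → Dec (Matches ch c)
matches? ch c = ≟-char ch (just nothing) ⊎-dec ≟-char ch (just (just c))
  where
  ≟-char : DecidableEquality (Maybe (Maybe (Fin a)))
  ≟-char = Maybe.≡-dec (Maybe.≡-dec _≟ᶠ_)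

wildcard : Maybe (Maybe (Fin a)) → ℕ
wildcard (just nothing) = 1
wildcard _              = 0

just-matches⇒≡ : ∀ {b c : Fin a} → Matches (just (just b)) c → b ≡ c
just-matches⇒≡ (inj₂ refl) = refl

∑-matches : (ch : Maybe (Maybe (Fin (suc d)))) → ch ≢ nothing →
            ∑[ c < suc d ] indicator (matches? ch c) ≡ 1 + d * wildcard ch
∑-matches nothing ch≢nothing = contradiction refl ch≢nothing
∑-matches {d} (just nothing) _ = begin
  ∑[ c < suc d ] indicator (matches? (just nothing) c)
    ≡⟨ ∑-ones _ (λ c → indicator-yes (matches? (just nothing) c) (inj₁ refl)) ⟩
  suc d
    ≡⟨ cong suc (*-identityʳ d) ⟨
  1 + d * 1 ∎
  where open ≡-Reasoning
∑-matches {d} (just (just b)) _ = begin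
  ∑[ c < suc d ] indicator (matches? (just (just b)) c)
    ≡⟨ ∑-delta _ b (indicator-yes (matches? _ b) (inj₂ refl))
                   (λ c c≢b → indicator-no (matches? _ c) (c≢b ∘ sym ∘ just-matches⇒≡)) ⟩
  1
    ≡⟨ cong suc (*-zeroʳ d) ⟨
  1 + d * 0 ∎
  where open ≡-Reasoning

∑-indicator-matches : ∀ {R : Fin (suc d) → Set} (ch : Maybe (Maybe (Fin (suc d)))) → ch ≢ nothing →
                      (Q? : Dec Q) (R? : ∀ c → Dec (R c)) → (∀ c → R c ⇔ (Q × Matches ch c)) →
                      ∑[ c < suc d ] indicator (R? c) ≡ indicator Q? + d * (indicator Q? * wildcard ch)
∑-indicator-matches {d} ch ch≢nothing Q? R? R⇔Q×matches = begin
  ∑[ c < suc d ] indicator (R? c)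
    ≡⟨ sum-cong-≗ (λ c → trans (indicator-cong (R? c) (Q? ×-dec matches? ch c) (R⇔Q×matches c))
                                (indicator-× Q? (matches? ch c))) ⟩
  ∑[ c < suc d ] (q * indicator (matches? ch c))
    ≡⟨ *-distribˡ-sum q (indicator ∘ matches? ch) ⟨
  q * ∑[ c < suc d ] indicator (matches? ch c)
    ≡⟨ cong (q *_) (∑-matches ch ch≢nothing) ⟩
  q * (1 + d * wildcard ch)
    ≡⟨ distribute q d (wildcard ch) ⟩
  q + d * (q * wildcard ch) ∎
  where
  open ≡-Reasoning
  q : ℕ
  q = indicator Q?
  distribute : ∀ q d w → q * (1 + d * w) ≡ q + d * (q * w)
  distribute = solve-∀

¬nothing-Matches : ∀ {c : Fin a} → ¬ Matches nothing c
¬nothing-Matches (inj₁ ())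
¬nothing-Matches (inj₂ ())

letterOf : Maybe (Maybe (Fin (suc d))) → Fin (suc d)
letterOf (just (just b)) = b
letterOf _               = zero

matches-letterOf : (ch : Maybe (Maybe (Fin (suc d)))) → ch ≢ nothing → Matches ch (letterOf ch)
matches-letterOf nothing         ch≢nothing = contradiction refl ch≢nothing
matches-letterOf (just nothing)  _          = inj₁ refl
matches-letterOf (just (just b)) _          = inj₂ refl

Matches-injective : {ch ch′ : Maybe (Maybe (Fin (suc (suc d))))} →
                    (∀ c → Matches ch c ⇔ Matches ch′ c) → ch ≡ ch′
Matches-injective {ch = nothing} {nothing} _ = refl
Matches-injective {ch = nothing} {just s} same =
  contradiction (from (same _) (matches-letterOf (just s) λ ())) ¬nothing-Matches
Matches-injective {ch = just s} {nothing} same =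
  contradiction (to (same _) (matches-letterOf (just s) λ ())) ¬nothing-Matches
Matches-injective {ch = just nothing} {just nothing} _ = refl
-- punchIn b zero is a letter other than b.
Matches-injective {ch = just nothing} {just (just b)} same =
  contradiction (just-matches⇒≡ (to (same (punchIn b zero)) (inj₁ refl))) (punchInᵢ≢i b zero ∘ sym)
Matches-injective {ch = just (just b)} {just nothing} same =
  contradiction (just-matches⇒≡ (from (same (punchIn b zero)) (inj₁ refl))) (punchInᵢ≢i b zero ∘ sym)
Matches-injective {ch = just (just b)} {just (just b′)} same =
  cong (just ∘ just) (sym (just-matches⇒≡ (to (same b) (inj₂ refl))))

at-defined⇒< : ∀ (w : PartialWord a) m {ch} → at w m ≡ just ch → m < length w
at-defined⇒< (_ ∷ _) zero    _  = s≤s z≤n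
at-defined⇒< (_ ∷ w) (suc m) eq = s≤s (at-defined⇒< w m eq)

<⇒at-defined : ∀ (w : PartialWord a) {m} → m < length w → at w m ≢ nothing
<⇒at-defined (_ ∷ _) {zero}  _         ()
<⇒at-defined (_ ∷ w) {suc m} (s≤s m<n) = <⇒at-defined w m<n

≥⇒at-undefined : ∀ (w : PartialWord a) {m} → length w ≤ m → at w m ≡ nothing
≥⇒at-undefined []      _         = refl
≥⇒at-undefined (_ ∷ w) (s≤s n≤m) = ≥⇒at-undefined w n≤m

matches⇒< : ∀ (w : PartialWord a) {m c} → Matches (at w m) c → m < length w
matches⇒< w (inj₁ eq) = at-defined⇒< w _ eq
matches⇒< w (inj₂ eq) = at-defined⇒< w _ eq

at-take : ∀ (w : PartialWord a) {k m} → m < k → at (take k w) m ≡ at w m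
at-take []      {zero}  _ = refl
at-take []      {suc k} _ = refl
at-take (_ ∷ _) {suc k} {zero}  _         = refl
at-take (_ ∷ w) {suc k} {suc m} (s≤s m<k) = at-take w m<k

at-take-≥ : ∀ (w : PartialWord a) {k m} → k ≤ m → at (take k w) m ≡ nothing
at-take-≥ []      {zero}  _ = refl
at-take-≥ []      {suc k} _ = refl
at-take-≥ (_ ∷ _) {zero}  _         = refl
at-take-≥ (_ ∷ w) {suc k} (s≤s k≤m) = at-take-≥ w k≤m

at-drop : ∀ (w : PartialWord a) l m → at (drop l w) m ≡ at w (l + m)
at-drop w       zero    m = refl
at-drop []      (suc l) m = refl
at-drop (_ ∷ w) (suc l) m = at-drop w l m

at-extensional : ∀ (v w : PartialWord a) → (∀ m → at v m ≡ at w m) → v ≡ w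
at-extensional []      []      _    = refl
at-extensional []      (_ ∷ _) same = case same 0 of λ ()
at-extensional (_ ∷ _) []      same = case same 0 of λ ()
at-extensional (x ∷ v) (y ∷ w) same =
  cong₂ _∷_ (Maybe.just-injective (same 0)) (at-extensional v w (same ∘ suc))

border-from-letters : ∀ (w : PartialWord a) k → k ≤ length w →
                      ((t : Fin k) → at w (toℕ t) ≡ at w (length w ∸ k + toℕ t)) → HasBorder k w
border-from-letters w k k≤n same = at-extensional _ _ λ m → agree m (m <? k)
  where
  open ≡-Reasoning
  l : ℕ
  l = length w ∸ k
  agree : ∀ m → Dec (m < k) → at (take k w) m ≡ at (drop l w) m
  agree m (yes m<k) = begin
    at (take k w) m    ≡⟨ at-take w m<k ⟩
    at w m             ≡⟨ cong (at w) (toℕ-fromℕ< m<k) ⟨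
    at w (toℕ t)       ≡⟨ same t ⟩
    at w (l + toℕ t)   ≡⟨ cong (at w ∘ (l +_)) (toℕ-fromℕ< m<k) ⟩
    at w (l + m)       ≡⟨ at-drop w l m ⟨
    at (drop l w) m    ∎
    where
    t : Fin k
    t = fromℕ< m<k
  agree m (no m≮k) = begin
    at (take k w) m    ≡⟨ at-take-≥ w (≮⇒≥ m≮k) ⟩
    nothing            ≡⟨ ≥⇒at-undefined w (subst (_≤ l + m) (m∸n+n≡m k≤n) (+-monoʳ-≤ l (≮⇒≥ m≮k))) ⟨
    at w (l + m)       ≡⟨ at-drop w l m ⟨
    at (drop l w) m    ∎

_∷ʳ_ : ∀ {A : Set} → Vector A k → A → Vector A (suc k)
_∷ʳ_ {zero}  u c _ = c
_∷ʳ_ {suc k} u c   = head u ∷ᵥ (tail u ∷ʳ c)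

∷ʳ-inject₁ : ∀ {A : Set} (u : Vector A k) c t → (u ∷ʳ c) (inject₁ t) ≡ u t
∷ʳ-inject₁ {suc k} u c zero    = refl
∷ʳ-inject₁ {suc k} u c (suc t) = ∷ʳ-inject₁ (tail u) c t

∷ʳ-fromℕ : ∀ {A : Set} (u : Vector A k) c → (u ∷ʳ c) (fromℕ k) ≡ c
∷ʳ-fromℕ {zero}  u c = refl
∷ʳ-fromℕ {suc k} u c = ∷ʳ-fromℕ (tail u) c

data Inject₁OrFromℕ : Fin (suc k) → Set where
  is-inject₁ : (t : Fin k) → Inject₁OrFromℕ (inject₁ t)
  is-fromℕ   : Inject₁OrFromℕ (fromℕ k)

inject₁-or-fromℕ : (j : Fin (suc k)) → Inject₁OrFromℕ j
inject₁-or-fromℕ {zero}  zero = is-fromℕ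
inject₁-or-fromℕ {suc k} zero = is-inject₁ zero
inject₁-or-fromℕ {suc k} (suc j) with inject₁-or-fromℕ j
... | is-inject₁ t = is-inject₁ (suc t)
... | is-fromℕ     = is-fromℕ

module _ (w : PartialWord a) where

  covers? : ∀ i (x : Vector (Fin a) n) → Dec (Covers w i x)
  covers? {n} i x = (i + n ≤? length w) ×-dec all? (λ j → matches? (at w (i + toℕ j)) (x j))

  matches-resp : ∀ {m m′ c c′} → m ≡ m′ → c ≡ c′ → Matches (at w m) c → Matches (at w m′) c′
  matches-resp refl refl = id

  covers-head-tail : ∀ {i} (x : Vector (Fin a) (suc k)) →
                     Covers w i x ⇔ (Covers w (suc i) (tail x) × Matches (at w i) (head x))
  covers-head-tail {k} {i} x = mk⇔
    (λ (fits , matches) → (subst (_≤ length w) (+-suc i k) fits ,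
                           λ t → matches-resp (+-suc i (toℕ t)) refl (matches (suc t))) ,
                          matches-resp (+-identityʳ i) refl (matches zero))
    (λ ((fits , matches) , first) → subst (_≤ length w) (sym (+-suc i k)) fits , λ where
       zero    → matches-resp (sym (+-identityʳ i)) refl first
       (suc t) → matches-resp (sym (+-suc i (toℕ t))) refl (matches t))

  covers-∷ʳ : ∀ {i} (u : Vector (Fin a) k) c →
              Covers w i (u ∷ʳ c) ⇔ (Covers w i u × Matches (at w (i + k)) c)
  covers-∷ʳ {k} {i} u c = mk⇔
    (λ (fits , matches) → (≤-trans (+-monoʳ-≤ i (n≤1+n k)) fits ,
                           λ t → matches-resp (cong (i +_) (toℕ-inject₁ t)) (∷ʳ-inject₁ u c t)
                                              (matches (inject₁ t))) ,
                          matches-resp (cong (i +_) (toℕ-fromℕ k)) (∷ʳ-fromℕ u c) (matches (fromℕ k)))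
    (λ ((_ , matches) , final) → subst (_≤ length w) (sym (+-suc i k)) (matches⇒< w final) ,
                                 λ j → extend matches final (inject₁-or-fromℕ j))
    where
    extend : ((t : Fin k) → Matches (at w (i + toℕ t)) (u t)) → Matches (at w (i + k)) c →
             ∀ {j} → Inject₁OrFromℕ j → Matches (at w (i + toℕ j)) ((u ∷ʳ c) j)
    extend matches _ (is-inject₁ t) =
      matches-resp (cong (i +_) (sym (toℕ-inject₁ t))) (sym (∷ʳ-inject₁ u c t)) (matches t)
    extend _ final is-fromℕ =
      matches-resp (cong (i +_) (sym (toℕ-fromℕ k))) (sym (∷ʳ-fromℕ u c)) final

  updateAt-covers : ∀ {i} {u : Vector (Fin a) k} {t c} →
                    Covers w i u → Matches (at w (i + toℕ t)) c → Covers w i (updateAt u t (const c))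
  updateAt-covers {i = i} {u} {t} {c} (fits , matches) matches-c = fits , matches′
    where
    matches′ : ∀ j → Matches (at w (i + toℕ j)) (updateAt u t (const c) j)
    matches′ j with j ≟ᶠ t
    ... | yes refl = matches-resp refl (sym (updateAt-updates t u)) matches-c
    ... | no j≢t   = matches-resp refl (sym (updateAt-minimal j t u j≢t)) (matches j)

  matches-transfer : ∀ {i i′} {u : Vector (Fin a) k} → (∀ v → Covers w i v → Covers w i′ v) →
                     Covers w i u → ∀ t {c} → Matches (at w (i + toℕ t)) c → Matches (at w (i′ + toℕ t)) c
  matches-transfer {u = u} covers⇒ covered t matches-c =
    matches-resp refl (updateAt-updates t u) (proj₂ (covers⇒ _ (updateAt-covers covered matches-c)) t)

  position-bound : ∀ {i} {x : Vector (Fin a) (suc k)} → Covers w i x → i < length w ∸ k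
  position-bound {k} {i} (fits , _) = m+n≤o⇒m≤o∸n (suc i) (subst (_≤ length w) (+-suc i k) fits)

  covering-count : IsUniversal a (suc k) w → (x : Vector (Fin a) (suc k)) →
                   ∑[ i < length w ∸ k ] indicator (covers? (toℕ i) x) ≡ 1
  covering-count {k} universal x with universal x
  ... | i , covered , unique = ∑-delta _ (fromℕ< i<l)
          (indicator-yes (covers? _ x) (subst (λ j → Covers w j x) (sym (toℕ-fromℕ< i<l)) covered))
          (λ j j≢i → indicator-no (covers? _ x) λ covered′ →
             j≢i (toℕ-injective (trans (unique _ covered′) (sym (toℕ-fromℕ< i<l)))))
    where
    i<l : i < length w ∸ k
    i<l = position-bound covered

covered-word : ∀ (w : PartialWord (suc d)) i → i + k ≤ length w → Σ (Vector (Fin (suc d)) k) (Covers w i)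
covered-word w i fits = (λ t → letterOf (at w (i + toℕ t))) , fits ,
  λ t → matches-letterOf _ (<⇒at-defined w (<-≤-trans (+-monoʳ-< i (toℕ<n t)) fits))

same-coverage⇒same-letters : ∀ (w : PartialWord (suc (suc d))) {i i′} → i + k ≤ length w → i′ + k ≤ length w →
                             (∀ u → Covers w i u ⇔ Covers w i′ u) →
                             (t : Fin k) → at w (i + toℕ t) ≡ at w (i′ + toℕ t)
same-coverage⇒same-letters w {i} {i′} fits fits′ same t = Matches-injective λ c → mk⇔
  (matches-transfer w (to ∘ same) (proj₂ (covered-word w i fits)) t)
  (matches-transfer w (from ∘ same) (proj₂ (covered-word w i′ fits′)) t)

residue-injective : ∀ {d x y X Y} → x < d → y < d → x + d * X ≡ y + d * Y → x ≡ y
residue-injective {d@(suc _)} {x} {y} {X} {Y} x<d y<d eq = begin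
  x                ≡⟨ m<n⇒m%n≡m x<d ⟨
  x % d            ≡⟨ [m+kn]%n≡m%n x X d ⟨
  (x + X * d) % d  ≡⟨ cong (_% d) (trans (cong (x +_) (*-comm X d)) (trans eq (cong (y +_) (*-comm d Y)))) ⟩
  (y + Y * d) % d  ≡⟨ [m+kn]%n≡m%n y Y d ⟩
  y % d            ≡⟨ m<n⇒m%n≡m y<d ⟩
  y                ∎
  where open ≡-Reasoning

shifted-residues : ∀ d {n x y A B X Y} → A + d * X ≡ n → B + d * Y ≡ n → x + B ≡ A + y →
                   x + d * X ≡ y + d * Y
shifted-residues d {n} {x} {y} {A} {B} {X} {Y} eqA eqB shift = +-cancelʳ-≡ n _ _ (begin
  x + d * X + n              ≡⟨ cong (x + d * X +_) eqB ⟨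
  x + d * X + (B + d * Y)    ≡⟨ regroup₁ x (d * X) B (d * Y) ⟩
  x + B + d * X + d * Y      ≡⟨ cong (λ z → z + d * X + d * Y) shift ⟩
  A + y + d * X + d * Y      ≡⟨ regroup₂ A y (d * X) (d * Y) ⟩
  A + d * X + (y + d * Y)    ≡⟨ cong (_+ (y + d * Y)) eqA ⟩
  n + (y + d * Y)            ≡⟨ +-comm n _ ⟩
  y + d * Y + n              ∎)
  where
  open ≡-Reasoning
  regroup₁ : ∀ x p B q → x + p + (B + q) ≡ x + B + p + q
  regroup₁ = solve-∀
  regroup₂ : ∀ A y p q → A + y + p + q ≡ A + p + (y + q)
  regroup₂ = solve-∀

module Universal (w : PartialWord (suc d)) (universal : IsUniversal (suc d) (suc k) w) where

  private
    l : ℕ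
    l = length w ∸ k

  universal⇒k<length : k < length w
  universal⇒k<length with universal (const zero)
  ... | i , (fits , _) , _ = m+n≤o⇒n≤o i fits

  l+k≡length : l + k ≡ length w
  l+k≡length = m∸n+n≡m (<⇒≤ universal⇒k<length)

  private
    i+k<length : (i : Fin l) → toℕ i + k < length w
    i+k<length i = subst (toℕ i + k <_) l+k≡length (+-monoˡ-< k (toℕ<n i))

    i<length : (i : Fin l) → toℕ i < length w
    i<length i = ≤-<-trans (m≤m+n (toℕ i) k) (i+k<length i)

  module _ (u : Vector (Fin (suc d)) k) where

    private
      G : ℕ → ℕ
      G i = indicator (covers? w i u)

    right-extensions : ∑[ i < l ] G (toℕ i) + d * ∑[ i < l ] (G (toℕ i) * wildcard (at w (toℕ i + k)))
                       ≡ suc d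
    right-extensions = double-count d (λ i c → indicator (covers? w (toℕ i) (u ∷ʳ c))) _ _
      (covering-count w universal ∘ (u ∷ʳ_))
      (λ i → ∑-indicator-matches _ (<⇒at-defined w (i+k<length i))
               (covers? w (toℕ i) u) (λ c → covers? w (toℕ i) (u ∷ʳ c)) (covers-∷ʳ w u))

    left-extensions : ∑[ i < l ] G (suc (toℕ i)) + d * ∑[ i < l ] (G (suc (toℕ i)) * wildcard (at w (toℕ i)))
                      ≡ suc d
    left-extensions = double-count d (λ i c → indicator (covers? w (toℕ i) (c ∷ᵥ u))) _ _
      (covering-count w universal ∘ (_∷ᵥ u))
      (λ i → ∑-indicator-matches _ (<⇒at-defined w (i<length i))
               (covers? w (suc (toℕ i)) u) (λ c → covers? w (toℕ i) (c ∷ᵥ u))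
               (λ c → covers-head-tail w (c ∷ᵥ u)))

    split-first≡split-last : G 0 + ∑[ i < l ] G (suc (toℕ i)) ≡ ∑[ i < l ] G (toℕ i) + G l
    split-first≡split-last = begin
      ∑[ i < suc l ] G (toℕ i)                           ≡⟨ sum-init-last {l} (G ∘ toℕ) ⟩
      ∑[ i < l ] G (toℕ (inject₁ i)) + G (toℕ (fromℕ l)) ≡⟨ cong₂ _+_ (sum-cong-≗ {l} (cong G ∘ toℕ-inject₁))
                                                                    (cong G (toℕ-fromℕ l)) ⟩
      ∑[ i < l ] G (toℕ i) + G l                         ∎
      where open ≡-Reasoning

    covers-first⇔last : 2 ≤ d → Covers w 0 u ⇔ Covers w l u
    covers-first⇔last 2≤d = indicator-injective (covers? w 0 u) (covers? w l u)
      (residue-injective (<-≤-trans (indicator<2 _) 2≤d) (<-≤-trans (indicator<2 _) 2≤d)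
        (shifted-residues d {x = G 0} {y = G l} right-extensions left-extensions split-first≡split-last))

lemma4p4 : (a n : ℕ) → 3 ≤ a → 1 ≤ n → (w : PartialWord a) →
    IsUniversal a n w → HasBorder (n ∸ 1) w
lemma4p4 (suc (suc (suc d))) (suc k) (s≤s (s≤s (s≤s _))) (s≤s _) w universal =
  border-from-letters w k k≤length
    (same-coverage⇒same-letters w k≤length (≤-reflexive l+k≡length)
      (λ u → covers-first⇔last u (s≤s (s≤s z≤n))))
  where
  open Universal w universal
  k≤length : k ≤ length w
  k≤length = <⇒≤ universal⇒k<length
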